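{- Let $A=\left\{\sum_{t\in H_{1}}2^{2t}+\sum_{t\in H_{2}}2^{2t+1}: H_1,H_2 \text{ nonempty finite subsets of }\mathbb{N},\ H_{1}<H_{2}\right\}$. Then $A$ is an $IP_{\infty}$-set but not an $IP$-set. Consequently $\mathbb{N}\setminus A$ is an $IP^{\star}$-set which is not an $IP^{2\star}$-set and is not an $IP_{r}^{\star}$-set for any $r\in\mathbb{N}$.
   Context: For finite nonempty $H,K\subseteq\mathbb{N}$, $H<K$ means $\max H<\min K$. A set is an $IP$-set if it contains $FS(\langle x_n\rangle_{n=1}^\infty)=\{\sum_{t\in H}x_t:H\text{ nonempty finite}\}$ for some sequence in $\mathbb{N}$; $IP^{\star}$-sets are sets meeting every $IP$-set. For $r\in\mathbb{N}$, an $IP_r$-set is a set containing $\{\sum_{n\in F}x_n:\emptyset\ne F\subseteq\{1,\dots,r\}\}$ for some $x_1,\dots,x_r\in\mathbb{N}$; $IP_r^{\star}$-sets meet every $IP_r$-set; an $IP_\infty$-set is a set that is an $IP_r$-set for every $r\in\mathbb{N}$. An $IP^{2}$-set is a set containing $\{\sum_{t\in H_1}x_t+\sum_{t\in H_2}y_t:H_1<H_2\text{ nonempty finite}\}$ for some sequences $\langle x_t\rangle,\langle y_t\rangle$ in $\mathbb{N}$; $IP^{2\star}$-sets meet every $IP^2$-set. -}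

module Defs where

open import Data.Nat using (ℕ; zero; suc; _+_; _*_; _^_; _≤_; _<_)
open import Data.Nat.ListAction using (sum)
open import Data.List using (List; []; _∷_; map)
open import Data.Empty using (⊥)
open import Data.Unit using (⊤)
open import Relation.Binary.PropositionalEquality using (_≡_)
open import Data.List.Relation.Unary.All using (All)
open import Data.List.Relation.Unary.Linked using (Linked)
open import Data.Product using (Σ; ∃; ∃-syntax; _×_)
open import Relation.Nullary using (¬_)
open import Level using (Level)

-- Convention: ℕ of the paper = {1,2,3,...}; Agda's ℕ contains 0, so
-- positivity is imposed explicitly where needed.

Pred : Set₁
Pred = ℕ → Set

-- A nonempty finite subset H of the paper's ℕ, represented as a
-- strictly increasing (hence duplicate-free) nonempty list of positive naturals.
NonEmpty : List ℕ → Set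
NonEmpty []      = ⊥
NonEmpty (_ ∷ _) = ⊤

record FinIdx (H : List ℕ) : Set where
  field
    nonempty   : NonEmpty H
    increasing : Linked _<_ H
    positive   : All (λ t → 1 ≤ t) H

Σ[_]_ : List ℕ → (ℕ → ℕ) → ℕ
Σ[ H ] x = sum (map x H)

_≺_ : List ℕ → List ℕ → Set
H ≺ K = All (λ a → All (λ b → a < b) K) H

-- a sequence in ℕ (positive values; index 0 is never used)
PosSeq : (ℕ → ℕ) → Set
PosSeq x = ∀ n → 1 ≤ n → 1 ≤ x n

IPSet : Pred → Set
IPSet S = ∃[ x ] (PosSeq x × (∀ H → FinIdx H → S (Σ[ H ] x)))

IPrSet : ℕ → Pred → Set
IPrSet r S = ∃[ x ] (PosSeq x × (∀ H → FinIdx H → All (λ t → t ≤ r) H → S (Σ[ H ] x)))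

IPinfSet : Pred → Set
IPinfSet S = ∀ r → 1 ≤ r → IPrSet r S

IP2Set : Pred → Set
IP2Set S = ∃[ x ] ∃[ y ] (PosSeq x × PosSeq y ×
  (∀ H₁ H₂ → FinIdx H₁ → FinIdx H₂ → H₁ ≺ H₂ → S (Σ[ H₁ ] x + Σ[ H₂ ] y)))

Meets : Pred → Pred → Set
Meets S B = ∃[ n ] (S n × B n)

IPStar : Pred → Set₁
IPStar S = ∀ B → IPSet B → Meets S B

IPrStar : ℕ → Pred → Set₁
IPrStar r S = ∀ B → IPrSet r B → Meets S B

IP2Star : Pred → Set₁
IP2Star S = ∀ B → IP2Set B → Meets S B

Compl : Pred → Pred
Compl S n = 1 ≤ n × ¬ S n

A : Pred
A n = ∃[ H₁ ] ∃[ H₂ ] (FinIdx H₁ × FinIdx H₂ × H₁ ≺ H₂ ×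
  n ≡ Σ[ H₁ ] (λ t → 2 ^ (2 * t)) + Σ[ H₂ ] (λ t → 2 ^ (2 * t + 1)))

-- In base 4 an element of A has digit 1 exactly at the places in H₁ and digit 2 exactly at those
-- in H₂, all 1s below all 2s: its lowest nonzero digit is 1 and its leading digit is 2.  Given a
-- sequence x, either x₁ has leading digit other than 2 or some x_j lowest nonzero digit other
-- than 1, and that term lies outside A; or 2·4^S ≤ x₁ < 4^(S+1) and among x₂, …, x_{S+3} some x_j
-- has its lowest 1 above place S, so that x₁ + x_j ∉ A because below that 1 only 1s may occur; or,
-- by pigeonhole, two of them have it at the same place and their sum has lowest nonzero digit 2.
-- So ℕ∖A is IP⋆, whence A is not IP; A is IP² by definition and IP_r via x_i = 4^i + 2·4^(r+i),
-- so ℕ∖A is neither IP²⋆ nor IP_r⋆.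

module Submission where

open import Defs
open import Data.Nat using (ℕ; zero; suc; _+_; _*_; _^_; _∸_; _≤_; _<_; z≤n; s≤s; NonZero; _≟_; _<?_; _≤?_)
open import Data.Nat.Properties
open import Data.Nat.Divisibility using (_∣_; divides; _∣0; ∣m∣n⇒∣m+n)
open import Data.Nat.DivMod using (_%_; [m+kn]%n≡m%n; m<n⇒m%n≡m)
open import Data.Nat.ListAction using (sum)
open import Data.Nat.Tactic.RingSolver using (solve-∀)
open import Data.Fin using (Fin; toℕ; fromℕ<)
import Data.Fin.Properties as Fin
open import Data.List using (List; []; _∷_; map; filter)
open import Data.List.Properties using (map-∘)
open import Data.List.Relation.Unary.All as All using (All; []; _∷_)
import Data.List.Relation.Unary.All.Properties as All
import Data.List.Relation.Unary.Any as Any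
open import Data.List.Relation.Unary.AllPairs as AllPairs using (AllPairs; []; _∷_)
import Data.List.Relation.Unary.AllPairs.Properties as AllPairs
open import Data.List.Relation.Unary.Linked as Linked using (Linked; [-]; _∷_)
import Data.List.Relation.Unary.Linked.Properties as Linked
open import Data.Product using (∃; ∃-syntax; _×_; _,_; proj₁; proj₂)
open import Data.Sum using (_⊎_; inj₁; inj₂)
open import Data.Empty using (⊥-elim)
open import Data.Unit using (tt)
open import Function using (_∘_)
open import Relation.Binary.PropositionalEquality
open import Relation.Nullary using (¬_; Dec; yes; no)
open import Relation.Nullary.Decidable using (map′; _×-dec_)
open import Relation.Unary using (Decidable)
open import Relation.Unary.Properties using (∁?)

four^_ : ℕ → ℕ
four^ t = 2 ^ (2 * t)

four^-nonZero : ∀ t → NonZero (four^ t)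
four^-nonZero t = m^n≢0 2 (2 * t)

four^-pos : ∀ t → 0 < four^ t
four^-pos t = m^n>0 2 (2 * t)

four^-+ : ∀ s t → four^ (s + t) ≡ four^ s * four^ t
four^-+ s t = trans (cong (2 ^_) (*-distribˡ-+ 2 s t)) (^-distribˡ-+-* 2 (2 * s) (2 * t))

four^-suc : ∀ t → four^ (suc t) ≡ 4 * four^ t
four^-suc = four^-+ 1

four^-suc-* : ∀ t m → four^ (suc t) * m ≡ 4 * (four^ t * m)
four^-suc-* t m = trans (cong (_* m) (four^-suc t)) (*-assoc 4 (four^ t) m)

four^-mono-≤ : ∀ {s t} → s ≤ t → four^ s ≤ four^ t
four^-mono-≤ s≤t = ^-monoʳ-≤ 2 (*-monoʳ-≤ 2 s≤t)

four^-cancel-< : ∀ {s t} → four^ s < four^ t → s < t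
four^-cancel-< 4^s<4^t = ≰⇒> (<⇒≱ 4^s<4^t ∘ four^-mono-≤)

four^-mono-∣ : ∀ {s t} → s ≤ t → four^ s ∣ four^ t
four^-mono-∣ {s} {t} s≤t = divides (four^ (t ∸ s)) (begin
  four^ t                  ≡⟨ cong four^_ (m+[n∸m]≡n s≤t) ⟨
  four^ (s + (t ∸ s))      ≡⟨ four^-+ s (t ∸ s) ⟩
  four^ s * four^ (t ∸ s)  ≡⟨ *-comm (four^ s) _ ⟩
  four^ (t ∸ s) * four^ s  ∎)
  where open ≡-Reasoning

four^-mono-< : ∀ {s t} → s < t → four^ s < four^ t
four^-mono-< s<t = ^-monoʳ-< 2 (s≤s (s≤s z≤n)) (*-monoʳ-< 2 s<t)

n<four^n : ∀ n → n < four^ n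
n<four^n zero    = s≤s z≤n
n<four^n (suc n) = ≤-<-trans (n<four^n n) (four^-mono-< (n<1+n n))

+2*four^<four^-suc : ∀ {X} t → X < four^ t → X + 2 * four^ t < four^ (suc t)
+2*four^<four^-suc {X} t X<4^t = begin-strict
  X + 2 * four^ t        <⟨ +-monoˡ-< (2 * four^ t) X<4^t ⟩
  four^ t + 2 * four^ t  ≡⟨ three (four^ t) ⟩
  3 * four^ t            ≤⟨ *-monoˡ-≤ (four^ t) {3} {4} (s≤s (s≤s (s≤s z≤n))) ⟩
  4 * four^ t            ≡⟨ four^-suc t ⟨
  four^ (suc t)          ∎
  where
  open ≤-Reasoning
  three : ∀ P → P + 2 * P ≡ 3 * P
  three = solve-∀

Σ-+ : ∀ H (f g : ℕ → ℕ) → Σ[ H ] (λ t → f t + g t) ≡ Σ[ H ] f + Σ[ H ] g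
Σ-+ []      f g = refl
Σ-+ (h ∷ H) f g = trans (cong (f h + g h +_) (Σ-+ H f g)) (interchange (f h) (g h) _ _)
  where
  interchange : ∀ a b c d → (a + b) + (c + d) ≡ (a + c) + (b + d)
  interchange = solve-∀

Σ-*ˡ : ∀ H c (f : ℕ → ℕ) → Σ[ H ] (λ t → c * f t) ≡ c * Σ[ H ] f
Σ-*ˡ []      c f = sym (*-zeroʳ c)
Σ-*ˡ (h ∷ H) c f = trans (cong (c * f h +_) (Σ-*ˡ H c f)) (sym (*-distribˡ-+ c (f h) _))

Σ-map : ∀ H (g f : ℕ → ℕ) → Σ[ map g H ] f ≡ Σ[ H ] (f ∘ g)
Σ-map H g f = cong sum (sym (map-∘ H))

Σ-cong : ∀ {H} {f g : ℕ → ℕ} → All (λ t → f t ≡ g t) H → Σ[ H ] f ≡ Σ[ H ] g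
Σ-cong []         = refl
Σ-cong (eq ∷ eqs) = cong₂ _+_ eq (Σ-cong eqs)

Σ-2·four^ : ∀ H → Σ[ H ] (λ t → 2 ^ (2 * t + 1)) ≡ 2 * Σ[ H ] four^_
Σ-2·four^ H = trans (Σ-cong {H} (All.tabulate (λ {t} _ → cong (2 ^_) (+-comm (2 * t) 1)))) (Σ-*ˡ H 2 four^_)

Σ-partition : ∀ {P : ℕ → Set} (P? : Decidable P) H (f : ℕ → ℕ) →
              Σ[ H ] f ≡ Σ[ filter P? H ] f + Σ[ filter (∁? P?) H ] f
Σ-partition P? []      f = refl
Σ-partition P? (h ∷ H) f with P? h
... | yes _ = trans (cong (f h +_) (Σ-partition P? H f)) (sym (+-assoc (f h) _ _))
... | no  _ = trans (cong (f h +_) (Σ-partition P? H f)) (swap (f h) (Σ[ filter P? H ] f) _)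
  where
  swap : ∀ a b c → a + (b + c) ≡ b + (a + c)
  swap = solve-∀

f≤Σ : ∀ (f : ℕ → ℕ) H → All (λ t → f t ≤ Σ[ H ] f) H
f≤Σ f []      = []
f≤Σ f (h ∷ H) = m≤m+n (f h) _ ∷ All.map (λ le → ≤-trans le (m≤n+m _ (f h))) (f≤Σ f H)

∣-Σ : ∀ {d} {f : ℕ → ℕ} {H} → All (λ t → d ∣ f t) H → d ∣ Σ[ H ] f
∣-Σ []           = _ ∣0
∣-Σ (d∣ft ∷ d∣s) = ∣m∣n⇒∣m+n d∣ft (∣-Σ d∣s)

Σ-pos : ∀ {x H} → PosSeq x → FinIdx H → 1 ≤ Σ[ H ] x
Σ-pos {H = []}    x-pos fi = ⊥-elim (FinIdx.nonempty fi)
Σ-pos {H = h ∷ _} x-pos fi = ≤-trans (x-pos h (All.head (FinIdx.positive fi))) (m≤m+n _ _)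

+-*-injective : ∀ d .{{_ : NonZero d}} {a b a′ b′} → a < d → a′ < d →
                a + b * d ≡ a′ + b′ * d → a ≡ a′ × b ≡ b′
+-*-injective d {a} {b} {a′} {b′} a<d a′<d eq =
  a≡a′ , *-cancelʳ-≡ b b′ d (+-cancelˡ-≡ a′ _ _ (trans (cong (_+ b * d) (sym a≡a′)) eq))
  where
  open ≡-Reasoning
  a≡a′ : a ≡ a′
  a≡a′ = begin
    a                  ≡⟨ m<n⇒m%n≡m a<d ⟨
    a % d              ≡⟨ [m+kn]%n≡m%n a b d ⟨
    (a + b * d) % d    ≡⟨ cong (_% d) eq ⟩
    (a′ + b′ * d) % d  ≡⟨ [m+kn]%n≡m%n a′ b′ d ⟩
    a′ % d             ≡⟨ m<n⇒m%n≡m a′<d ⟩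
    a′                 ∎

-- The summand four^ m, for m below all of L, is the slack that makes the induction go through.
3*Σfour^+four^≤four^ : ∀ {m T} L → AllPairs _<_ L → All (m ≤_) L → All (_< T) L → m ≤ T →
                       3 * Σ[ L ] four^_ + four^ m ≤ four^ T
3*Σfour^+four^≤four^ []      _ _ _ m≤T = four^-mono-≤ m≤T
3*Σfour^+four^≤four^ {m} {T} (h ∷ L) (h<L ∷ L-inc) (m≤h ∷ _) (h<T ∷ L<T) _ = begin
  3 * (four^ h + Σ[ L ] four^_) + four^ m  ≤⟨ +-monoʳ-≤ _ (four^-mono-≤ m≤h) ⟩
  3 * (four^ h + Σ[ L ] four^_) + four^ h  ≡⟨ regroup (four^ h) (Σ[ L ] four^_) ⟩
  3 * Σ[ L ] four^_ + 4 * four^ h          ≡⟨ cong (3 * Σ[ L ] four^_ +_) (four^-suc h) ⟨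
  3 * Σ[ L ] four^_ + four^ (suc h)        ≤⟨ 3*Σfour^+four^≤four^ L L-inc h<L L<T h<T ⟩
  four^ T                                  ∎
  where
  open ≤-Reasoning
  regroup : ∀ P S → 3 * (P + S) + P ≡ 3 * S + 4 * P
  regroup = solve-∀

3*Σfour^<four^ : ∀ {L T} → AllPairs _<_ L → All (_< T) L → 3 * Σ[ L ] four^_ < four^ T
3*Σfour^<four^ {L} {T} L-inc L<T = subst (_≤ four^ T) (+-comm (3 * Σ[ L ] four^_) 1)
  (3*Σfour^+four^≤four^ L L-inc (All.tabulate (λ _ → z≤n)) L<T z≤n)

Σfour^<four^ : ∀ {L T} → AllPairs _<_ L → All (_< T) L → Σ[ L ] four^_ < four^ T
Σfour^<four^ {L} L-inc L<T = ≤-<-trans (m≤n*m (Σ[ L ] four^_) 3) (3*Σfour^<four^ L-inc L<T)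

Σfour^+2*Σfour^<four^ : ∀ {L M T} → AllPairs _<_ L → All (_< T) L → AllPairs _<_ M → All (_< T) M →
                        Σ[ L ] four^_ + 2 * Σ[ M ] four^_ < four^ T
Σfour^+2*Σfour^<four^ {L} {M} {T} L-inc L<T M-inc M<T = *-cancelˡ-≤ 3 (begin
  3 * suc (X + 2 * Y)            ≡⟨ regroup X Y ⟩
  suc (3 * X) + 2 * suc (3 * Y)  ≤⟨ +-mono-≤ (3*Σfour^<four^ L-inc L<T) (*-monoʳ-≤ 2 (3*Σfour^<four^ M-inc M<T)) ⟩
  four^ T + 2 * four^ T          ≡⟨ three (four^ T) ⟩
  3 * four^ T                    ∎)
  where
  open ≤-Reasoning
  X Y : ℕ
  X = Σ[ L ] four^_
  Y = Σ[ M ] four^_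
  regroup : ∀ X Y → 3 * suc (X + 2 * Y) ≡ suc (3 * X) + 2 * suc (3 * Y)
  regroup = solve-∀
  three : ∀ P → P + 2 * P ≡ 3 * P
  three = solve-∀

∣-Σfour^ : ∀ {s H} → All (s ≤_) H → four^ s ∣ Σ[ H ] four^_
∣-Σfour^ H≥s = ∣-Σ (All.map four^-mono-∣ H≥s)

below : ℕ → List ℕ → List ℕ
below T = filter (_<? T)

Σfour^-below : ∀ T H → ∃[ c ] Σ[ H ] four^_ ≡ Σ[ below T H ] four^_ + c * four^ T
Σfour^-below T H with ∣-Σfour^ (All.map ≮⇒≥ (All.all-filter (∁? (_<? T)) H))
... | divides c eq = c , trans (Σ-partition (_<? T) H four^_) (cong (Σ[ below T H ] four^_ +_) eq)

LeadingDigitTwoAt : ℕ → ℕ → Set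
LeadingDigitTwoAt S n = 2 * four^ S ≤ n × n < four^ (suc S)

LeadingDigitTwo : ℕ → Set
LeadingDigitTwo n = ∃[ S ] LeadingDigitTwoAt S n

LowestDigitOneAt : ℕ → ℕ → Set
LowestDigitOneAt t n = ∃[ k ] n ≡ four^ t * (1 + 4 * k)

LowestDigitOne : ℕ → Set
LowestDigitOne n = ∃[ t ] LowestDigitOneAt t n

DigitsZeroOne : ℕ → Set
DigitsZeroOne n = ∃[ L ] (AllPairs _<_ L × n ≡ Σ[ L ] four^_)

leadingDigitTwo? : ∀ n → Dec (LeadingDigitTwo n)
leadingDigitTwo? n = map′ (λ (S , _ , lead) → S , lead) (λ (S , lead) → S , S<n lead , lead)
  (anyUpTo? (λ S → 2 * four^ S ≤? n ×-dec n <? four^ (suc S)) n)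
  where
  S<n : ∀ {S} → LeadingDigitTwoAt S n → S < n
  S<n {S} (lower , _) = <-≤-trans (n<four^n S) (≤-trans (m≤n*m (four^ S) 2) lower)

lowestDigitOne? : ∀ n → Dec (LowestDigitOne n)
lowestDigitOne? n = map′ (λ (t , _ , k , _ , eq) → t , k , eq) (λ (t , k , eq) → t , t<n {t} {k} eq , k , k<1+n {t} {k} eq , eq)
  (anyUpTo? (λ t → anyUpTo? (λ k → n ≟ four^ t * (1 + 4 * k)) (suc n)) n)
  where
  t<n : ∀ {t k} → n ≡ four^ t * (1 + 4 * k) → t < n
  t<n {t} {k} refl = <-≤-trans (n<four^n t) (m≤m*n (four^ t) (1 + 4 * k))
  k<1+n : ∀ {t k} → n ≡ four^ t * (1 + 4 * k) → k < suc n
  k<1+n {t} {k} refl = s≤s (≤-trans (≤-trans (m≤n*m k 4) (n≤1+n (4 * k))) (m≤n*m (1 + 4 * k) (four^ t) {{four^-nonZero t}}))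

¬leadingDigitTwo-digitsZeroOne : ∀ {S n} → DigitsZeroOne n → ¬ LeadingDigitTwoAt S n
¬leadingDigitTwo-digitsZeroOne {S} (L , L-inc , refl) (lower , upper) = <-irrefl refl (begin-strict
  6 * four^ S               ≡⟨ *-assoc 3 2 (four^ S) ⟩
  3 * (2 * four^ S)         ≤⟨ *-monoʳ-≤ 3 lower ⟩
  3 * Σ[ L ] four^_         <⟨ 3*Σfour^<four^ L-inc L<1+S ⟩
  four^ (suc S)             ≡⟨ four^-suc S ⟩
  4 * four^ S               ≤⟨ *-monoˡ-≤ (four^ S) {4} {6} (s≤s (s≤s (s≤s (s≤s z≤n)))) ⟩
  6 * four^ S               ∎)
  where
  open ≤-Reasoning
  L<1+S : All (_< suc S) L
  L<1+S = All.map (λ 4^t≤Σ → four^-cancel-< (≤-<-trans 4^t≤Σ upper)) (f≤Σ four^_ L)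

strictlyIncreasing : ∀ {H} → FinIdx H → AllPairs _<_ H
strictlyIncreasing fi = Linked.Linked⇒AllPairs <-trans (FinIdx.increasing fi)

digitExpansion : ∀ {n} H₁ H₂ → n ≡ Σ[ H₁ ] (λ t → 2 ^ (2 * t)) + Σ[ H₂ ] (λ t → 2 ^ (2 * t + 1)) →
                 n ≡ Σ[ H₁ ] four^_ + 2 * Σ[ H₂ ] four^_
digitExpansion H₁ H₂ n≡ = trans n≡ (cong (Σ[ H₁ ] four^_ +_) (Σ-2·four^ H₂))

A⇒lowestDigitOne : ∀ {n} → A n → LowestDigitOne n
A⇒lowestDigitOne ([] , _ , fi₁ , _) = ⊥-elim (FinIdx.nonempty fi₁)
A⇒lowestDigitOne {n} (h ∷ H₁ , H₂ , fi₁ , _ , h<H₂ ∷ _ , n≡) with strictlyIncreasing fi₁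
... | h<H₁ ∷ _ with ∣-Σfour^ h<H₁ | ∣-Σfour^ h<H₂
... | divides c₁ eq₁ | divides c₂ eq₂ = h , c₁ + 2 * c₂ , (begin
  n                                                          ≡⟨ digitExpansion (h ∷ H₁) H₂ n≡ ⟩
  (four^ h + Σ[ H₁ ] four^_) + 2 * Σ[ H₂ ] four^_            ≡⟨ cong₂ (λ u v → (four^ h + u) + 2 * v) eq₁ eq₂ ⟩
  (four^ h + c₁ * four^ (suc h)) + 2 * (c₂ * four^ (suc h))  ≡⟨ cong (λ P → (four^ h + c₁ * P) + 2 * (c₂ * P)) (four^-suc h) ⟩
  (four^ h + c₁ * (4 * four^ h)) + 2 * (c₂ * (4 * four^ h))  ≡⟨ factor (four^ h) c₁ c₂ ⟩
  four^ h * (1 + 4 * (c₁ + 2 * c₂))                          ∎)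
  where
  open ≡-Reasoning
  factor : ∀ P c₁ c₂ → (P + c₁ * (4 * P)) + 2 * (c₂ * (4 * P)) ≡ P * (1 + 4 * (c₁ + 2 * c₂))
  factor = solve-∀

leadingDigitTwo-+2*Σfour^ : ∀ {X} h L → Linked _<_ (h ∷ L) → X < four^ h →
                            LeadingDigitTwo (X + 2 * Σ[ h ∷ L ] four^_)
leadingDigitTwo-+2*Σfour^ {X} h [] _ X<4^h =
  h , subst (LeadingDigitTwoAt h) (cong (λ s → X + 2 * s) (sym (+-identityʳ (four^ h))))
          (m≤n+m _ X , +2*four^<four^-suc h X<4^h)
leadingDigitTwo-+2*Σfour^ {X} h (h′ ∷ L) (h<h′ ∷ L-inc) X<4^h =
  subst LeadingDigitTwo regroup
    (leadingDigitTwo-+2*Σfour^ h′ L L-inc (<-≤-trans (+2*four^<four^-suc h X<4^h) (four^-mono-≤ h<h′)))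
  where
  regroup : X + 2 * four^ h + 2 * Σ[ h′ ∷ L ] four^_ ≡ X + 2 * Σ[ h ∷ h′ ∷ L ] four^_
  regroup = trans (+-assoc X _ _) (cong (X +_) (sym (*-distribˡ-+ 2 (four^ h) _)))

A⇒leadingDigitTwo : ∀ {n} → A n → LeadingDigitTwo n
A⇒leadingDigitTwo (_ , [] , _ , fi₂ , _) = ⊥-elim (FinIdx.nonempty fi₂)
A⇒leadingDigitTwo (H₁ , h ∷ H₂ , fi₁ , fi₂ , H₁≺H₂ , n≡) =
  subst LeadingDigitTwo (sym (digitExpansion H₁ (h ∷ H₂) n≡))
    (leadingDigitTwo-+2*Σfour^ h H₂ (FinIdx.increasing fi₂)
      (Σfour^<four^ (strictlyIncreasing fi₁) (All.map All.head H₁≺H₂)))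

below<T : ∀ T H → All (_< T) (below T H)
below<T T = All.all-filter (_<? T)

below-increasing : ∀ T {H} → AllPairs _<_ H → AllPairs _<_ (below T H)
below-increasing T = AllPairs.filter⁺ (_<? T)

splitExpansion-onesBelow : ∀ T H₁ {H₂} → All (T ≤_) H₂ →
  ∃[ c ] Σ[ H₁ ] four^_ + 2 * Σ[ H₂ ] four^_ ≡ Σ[ below T H₁ ] four^_ + c * four^ T
splitExpansion-onesBelow T H₁ {H₂} H₂≥T with Σfour^-below T H₁ | ∣-Σfour^ H₂≥T
... | c₁ , eq₁ | divides c₂ eq₂ = c₁ + 2 * c₂ ,
  trans (cong₂ (λ u v → u + 2 * v) eq₁ eq₂) (regroup (Σ[ below T H₁ ] four^_) c₁ c₂ (four^ T))
  where
  regroup : ∀ a c₁ c₂ P → (a + c₁ * P) + 2 * (c₂ * P) ≡ a + (c₁ + 2 * c₂) * P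
  regroup = solve-∀

splitExpansion-twosBelow : ∀ T H₁ H₂ →
  ∃[ c ] Σ[ H₁ ] four^_ + 2 * Σ[ H₂ ] four^_
       ≡ (Σ[ H₁ ] four^_ + 2 * Σ[ below T H₂ ] four^_) + (2 * c) * four^ T
splitExpansion-twosBelow T H₁ H₂ with Σfour^-below T H₂
... | c , eq = c ,
  trans (cong (λ v → Σ[ H₁ ] four^_ + 2 * v) eq) (regroup (Σ[ H₁ ] four^_) (Σ[ below T H₂ ] four^_) c (four^ T))
  where
  regroup : ∀ a b c P → a + 2 * (b + c * P) ≡ (a + 2 * b) + (2 * c) * P
  regroup = solve-∀

≺-above : ∀ {T H₁ H₂} → H₁ ≺ H₂ → Any.Any (T ≤_) H₁ → All (T ≤_) H₂
≺-above H₁≺H₂ T≤someH₁ with All.lookupAny H₁≺H₂ T≤someH₁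
... | h<H₂ , T≤h = All.map (λ h<t → ≤-trans T≤h (<⇒≤ h<t)) h<H₂

-- Reading an element of A modulo 4^T: if some 1 sits at or above place T then every 2 does,
-- so only 1s remain below T; otherwise all 1s lie below T and the quotient is even.
A⇒digitsZeroOne⊎2∣ : ∀ T {a b} → a < four^ T → A (a + b * four^ T) → DigitsZeroOne a ⊎ 2 ∣ b
A⇒digitsZeroOne⊎2∣ T {a} {b} a<4^T (H₁ , H₂ , fi₁ , fi₂ , H₁≺H₂ , n≡) with Any.any? (T ≤?_) H₁
... | yes T≤someH₁ with splitExpansion-onesBelow T H₁ (≺-above H₁≺H₂ T≤someH₁)
...   | c , eq = inj₁ (below T H₁ , low-inc ,
        proj₁ (+-*-injective (four^ T) {{four^-nonZero T}} {b = b} {b′ = c} a<4^T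
          (Σfour^<four^ low-inc (below<T T H₁)) (trans (digitExpansion H₁ H₂ n≡) eq)))
  where
  low-inc : AllPairs _<_ (below T H₁)
  low-inc = below-increasing T (strictlyIncreasing fi₁)
A⇒digitsZeroOne⊎2∣ T {a} {b} a<4^T (H₁ , H₂ , fi₁ , fi₂ , H₁≺H₂ , n≡) | no ¬T≤someH₁
  with splitExpansion-twosBelow T H₁ H₂
... | c , eq = inj₂ (divides c (trans b≡2c (*-comm 2 c)))
  where
  H₁<T : All (_< T) H₁
  H₁<T = All.map ≰⇒> (All.¬Any⇒All¬ H₁ ¬T≤someH₁)
  b≡2c : b ≡ 2 * c
  b≡2c = proj₂ (+-*-injective (four^ T) {{four^-nonZero T}} {b = b} {b′ = 2 * c} a<4^T
    (Σfour^+2*Σfour^<four^ (strictlyIncreasing fi₁) H₁<T (below-increasing T (strictlyIncreasing fi₂)) (below<T T H₂))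
    (trans (digitExpansion H₁ H₂ n≡) eq))

2∤1+4k : ∀ k → ¬ 2 ∣ 1 + 4 * k
2∤1+4k k (divides c eq) = even≢odd c (2 * k) (begin
  2 * c              ≡⟨ *-comm 2 c ⟩
  c * 2              ≡⟨ eq ⟨
  1 + 4 * k          ≡⟨ cong suc (*-assoc 2 2 k) ⟩
  suc (2 * (2 * k))  ∎)
  where open ≡-Reasoning

four^*[1+4k]≢four^*[2+4c] : ∀ e s k c → four^ e * (1 + 4 * k) ≢ four^ s * (2 + 4 * c)
four^*[1+4k]≢four^*[2+4c] zero s k c eq = even≢odd (four^ s * (1 + 2 * c)) (2 * k) (begin
  2 * (four^ s * (1 + 2 * c))  ≡⟨ double (four^ s) c ⟩
  four^ s * (2 + 4 * c)        ≡⟨ eq ⟨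
  1 * (1 + 4 * k)              ≡⟨ *-identityˡ _ ⟩
  1 + 4 * k                    ≡⟨ cong suc (*-assoc 2 2 k) ⟩
  suc (2 * (2 * k))            ∎)
  where
  open ≡-Reasoning
  double : ∀ P c → 2 * (P * (1 + 2 * c)) ≡ P * (2 + 4 * c)
  double = solve-∀
four^*[1+4k]≢four^*[2+4c] (suc e) zero k c eq = even≢odd X c (*-cancelˡ-≡ (2 * X) (suc (2 * c)) 2 (begin
  2 * (2 * X)                  ≡⟨ *-assoc 2 2 X ⟨
  4 * X                        ≡⟨ four^-suc-* e (1 + 4 * k) ⟨
  four^ (suc e) * (1 + 4 * k)  ≡⟨ eq ⟩
  1 * (2 + 4 * c)              ≡⟨ halve c ⟩
  2 * suc (2 * c)              ∎))
  where
  open ≡-Reasoning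
  X : ℕ
  X = four^ e * (1 + 4 * k)
  halve : ∀ c → 1 * (2 + 4 * c) ≡ 2 * suc (2 * c)
  halve = solve-∀
four^*[1+4k]≢four^*[2+4c] (suc e) (suc s) k c eq = four^*[1+4k]≢four^*[2+4c] e s k c
  (*-cancelˡ-≡ _ _ 4 (trans (sym (four^-suc-* e (1 + 4 * k))) (trans eq (four^-suc-* s (2 + 4 * c)))))

leadingTwo+higherOne∉A : ∀ {S t a n} → LeadingDigitTwoAt S a → S < t → LowestDigitOneAt t n → ¬ A (a + n)
leadingTwo+higherOne∉A {S} {t} {a} lead S<t (k , refl) a+n∈A
  with A⇒digitsZeroOne⊎2∣ t (<-≤-trans (proj₂ lead) (four^-mono-≤ S<t))
         (subst A (cong (a +_) (*-comm (four^ t) (1 + 4 * k))) a+n∈A)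
... | inj₁ a-digits01 = ¬leadingDigitTwo-digitsZeroOne {S} a-digits01 lead
... | inj₂ 2∣1+4k     = 2∤1+4k k 2∣1+4k

equalLowestOnes∉A : ∀ {t m n} → LowestDigitOneAt t m → LowestDigitOneAt t n → ¬ A (m + n)
equalLowestOnes∉A {t} (k , refl) (l , refl) m+n∈A with A⇒lowestDigitOne m+n∈A
... | t′ , k′ , eq = four^*[1+4k]≢four^*[2+4c] t′ t k′ (k + l)
  (trans (sym eq) (add (four^ t) k l))
  where
  add : ∀ P k l → P * (1 + 4 * k) + P * (1 + 4 * l) ≡ P * (2 + 4 * (k + l))
  add = solve-∀

module _ (x : ℕ → ℕ) where

  FiniteSum∉A : Set
  FiniteSum∉A = ∃[ H ] (FinIdx H × ¬ A (Σ[ H ] x))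

  singleton∉A : ∀ {j} → 1 ≤ j → ¬ A (x j) → FiniteSum∉A
  singleton∉A {j} 1≤j xⱼ∉A =
    j ∷ [] , record { nonempty = tt ; increasing = [-] ; positive = 1≤j ∷ [] } ,
    xⱼ∉A ∘ subst A (+-identityʳ (x j))

  pair∉A : ∀ {i j} → 1 ≤ i → i < j → ¬ A (x i + x j) → FiniteSum∉A
  pair∉A {i} {j} 1≤i i<j xᵢ+xⱼ∉A =
    i ∷ j ∷ [] , record { nonempty = tt ; increasing = i<j ∷ [-] ; positive = 1≤i ∷ ≤-trans 1≤i (<⇒≤ i<j) ∷ [] } ,
    xᵢ+xⱼ∉A ∘ subst A (cong (x i +_) (+-identityʳ (x j)))

  -- S + 2 terms but only S + 1 places ≤ S: if no lowest 1 lies above S, two lie at the same place.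
  finiteSum∉A-lowestOnes : ∀ {S} → LeadingDigitTwoAt S (x 1) →
                           ((j : Fin (2 + S)) → LowestDigitOne (x (2 + toℕ j))) → FiniteSum∉A
  finiteSum∉A-lowestOnes {S} lead low with Fin.any? (λ j → S <? proj₁ (low j))
  ... | yes (j , S<tⱼ) = pair∉A ≤-refl (s≤s (s≤s z≤n)) (leadingTwo+higherOne∉A lead S<tⱼ (proj₂ (low j)))
  ... | no ∄S<tⱼ with Fin.pigeonhole (n<1+n (suc S)) (λ j → fromℕ< (s≤s (≮⇒≥ (∄S<tⱼ ∘ (j ,_)))))
  ...   | i , j , i<j , same = pair∉A (s≤s z≤n) (s≤s (s≤s i<j))
          (equalLowestOnes∉A {proj₁ (low i)} (proj₂ (low i))
            (subst (λ t → LowestDigitOneAt t _) (sym (Fin.fromℕ<-injective _ _ _ _ same)) (proj₂ (low j))))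

  finiteSum∉A : FiniteSum∉A
  finiteSum∉A with leadingDigitTwo? (x 1)
  ... | no ¬lead = singleton∉A ≤-refl (¬lead ∘ A⇒leadingDigitTwo)
  ... | yes (S , lead) with Fin.all? (λ (j : Fin (2 + S)) → lowestDigitOne? (x (2 + toℕ j)))
  ...   | yes low = finiteSum∉A-lowestOnes lead low
  ...   | no ¬low with Fin.¬∀⟶∃¬ (2 + S) _ (λ j → lowestDigitOne? (x (2 + toℕ j))) ¬low
  ...     | j , ¬lowⱼ = singleton∉A (s≤s z≤n) (¬lowⱼ ∘ A⇒lowestDigitOne)

ℕ∖A-isIP⋆ : IPStar (Compl A)
ℕ∖A-isIP⋆ B (x , x-pos , FS⊆B) with finiteSum∉A x
... | H , fi , Σ∉A = Σ[ H ] x , (Σ-pos x-pos fi , Σ∉A) , FS⊆B H fi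

shift-finIdx : ∀ r {H} → FinIdx H → FinIdx (map (r +_) H)
shift-finIdx r {[]}    fi = ⊥-elim (FinIdx.nonempty fi)
shift-finIdx r {_ ∷ _} fi = record
  { nonempty   = tt
  ; increasing = Linked.map⁺ (Linked.map (+-monoʳ-< r) (FinIdx.increasing fi))
  ; positive   = All.map⁺ (All.map (λ {t} 1≤t → ≤-trans 1≤t (m≤n+m t r)) (FinIdx.positive fi))
  }

≺-shift : ∀ {r H} → All (_≤ r) H → All (1 ≤_) H → H ≺ map (r +_) H
≺-shift {r} H≤r H≥1 = All.map (λ a≤r → All.map⁺ (All.map (λ 1≤t → ≤-<-trans a≤r (m<m+n r 1≤t)) H≥1)) H≤r

A-isIPᵣ : ∀ r → IPrSet r A
A-isIPᵣ r = x , (λ n _ → ≤-trans (four^-pos n) (m≤m+n _ _)) ,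
  λ H fi H≤r → H , map (r +_) H , fi , shift-finIdx r fi , ≺-shift H≤r (FinIdx.positive fi) , Σx H
  where
  x : ℕ → ℕ
  x i = four^ i + 2 ^ (2 * (r + i) + 1)
  Σx : ∀ H → Σ[ H ] x ≡ Σ[ H ] four^_ + Σ[ map (r +_) H ] (λ t → 2 ^ (2 * t + 1))
  Σx H = trans (Σ-+ H four^_ _) (cong (Σ[ H ] four^_ +_) (sym (Σ-map H (r +_) _)))

A-isIP² : IP2Set A
A-isIP² = four^_ , (λ t → 2 ^ (2 * t + 1)) , (λ n _ → four^-pos n) , (λ n _ → m^n>0 2 (2 * n + 1)) ,
  λ H₁ H₂ fi₁ fi₂ H₁≺H₂ → H₁ , H₂ , fi₁ , fi₂ , H₁≺H₂ , refl

Compl-disjoint : ∀ {S} → ¬ Meets (Compl S) S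
Compl-disjoint (_ , (_ , n∉S) , n∈S) = n∉S n∈S

mainTheorem4 : IPinfSet A × ¬ IPSet A × IPStar (Compl A)
    × ¬ IP2Star (Compl A) × (∀ r → 1 ≤ r → ¬ IPrStar r (Compl A))
mainTheorem4 =
    (λ r _ → A-isIPᵣ r)
  , (λ A-isIP → Compl-disjoint (ℕ∖A-isIP⋆ A A-isIP))
  , ℕ∖A-isIP⋆
  , (λ ℕ∖A-isIP²⋆ → Compl-disjoint (ℕ∖A-isIP²⋆ A A-isIP²))
  , (λ r _ ℕ∖A-isIPᵣ⋆ → Compl-disjoint (ℕ∖A-isIPᵣ⋆ A (A-isIPᵣ r)))
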